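{- For every integer $k\geq 2$, every finite digraph $D$ admits a $\frac{1}{k}$-majority colouring using $2k$ colours; that is, there is a map $c:V(D)\to\{1,2,\dots,2k\}$ such that for every vertex $v$, the number of out-neighbours $w$ of $v$ with $c(w)=c(v)$ is at most $d^{+}(v)/k$, where $d^{+}(v)$ is the out-degree of $v$.
   Context: A $\frac{1}{k}$-majority colouring of a digraph is a colouring of its vertices such that each vertex receives the same colour as at most a $1/k$ proportion of its out-neighbours. A digraph is $\frac{1}{k}$-majority $m$-colourable if it has a $\frac{1}{k}$-majority colouring using $m$ colours. -}

module Defs where

open import Data.Nat using (ℕ; _*_; _≤_)
open import Data.Fin using (Fin)
open import Data.Bool using (Bool; true; false; _∧_)
open import Data.List using (List; length; filter; allFin)
open import Data.Fin.Properties using (_≟_)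
open import Relation.Binary.PropositionalEquality using (_≡_)
open import Relation.Nullary using (¬_)
open import Relation.Nullary.Decidable using (⌊_⌋)
open import Data.Bool.Properties using () renaming (_≟_ to _≟ᵇ_)
import Data.List as L

record Digraph : Set where
  field
    n         : ℕ
    arc       : Fin n → Fin n → Bool
    loopless  : ∀ v → arc v v ≡ false

open Digraph public

outNbrs : (D : Digraph) → Fin (n D) → List (Fin (n D))
outNbrs D v = L.filter (λ w → arc D v w ≟ᵇ true) (allFin (n D))

outdeg : (D : Digraph) → Fin (n D) → ℕ
outdeg D v = length (outNbrs D v)

sameOut : (D : Digraph) {m : ℕ} → (Fin (n D) → Fin m) → Fin (n D) → ℕ
sameOut D c v = length (L.filter (λ w → c w ≟ c v) (outNbrs D v))

-- c is a 1/k-majority colouring: each v has at most d⁺(v)/k out-neighbours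
-- of its own colour, i.e. k * #same ≤ d⁺(v) (exact, no rounding).
IsMajorityColouring : (k : ℕ) (D : Digraph) {m : ℕ} → (Fin (n D) → Fin m) → Set
IsMajorityColouring k D c = ∀ v → k * sameOut D c v ≤ outdeg D v

-- Weight every vertex by a positive integer x v with ∑_{u→v} x u ≤ (d⁺ v + 1) · x v; such weights
-- exist because v ↦ 1 + ⌊∑_{u→v} x u / (d⁺ v + 1)⌋ is monotone and keeps ∑_v (d⁺ v + 1) · x v bounded,
-- so iterating it from x = 1 reaches a fixed point of the inequality. Then run local search on the
-- weighted number of monochromatic arcs ∑_u x u · #{u → w : c w = c u}: recolouring v to j changes
-- it by the weighted number of arcs at v monochromatic under colour j minus that under c v. Summed
-- over the 2k colours these amounts total x v · d⁺ v + ∑_{u→v} x u < 2 x v (d⁺ v + 1), so the best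
-- colour costs less than x v (d⁺ v + 1) / k, while at a vertex violating the 1/k-condition the
-- current colour costs at least that much. The potential therefore drops until no vertex violates.
module Submission where

open import Defs
open import Data.Nat using (ℕ; zero; suc; _+_; _*_; _≤_; _<_; _≤?_; z≤n; s≤s; NonZero)
open import Data.Nat.Properties hiding (_≟_)
open import Data.Nat.DivMod using (_/_; _%_; m≡m%n+[m/n]*n; m%n<n; m/n*n≤m; /-monoˡ-≤)
open import Data.Nat.Tactic.RingSolver using (solve-∀)
open import Algebra.Properties.Semiring.Sum +-*-semiring
  using (sum; sum-syntax; sum-cong-≗; sum-replicate-zero; ∑-distrib-+; ∑-comm; *-distribˡ-sum)
open import Data.Fin using (Fin; zero; suc)
open import Data.Fin.Properties using (_≟_; all?; ¬∀⟶∃¬)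
open import Data.Bool using (true; false; if_then_else_)
open import Data.Bool.Properties using () renaming (_≟_ to _≟ᵇ_)
open import Data.List using (length; filter; tabulate)
open import Data.Product using (Σ; ∃; _×_; _,_)
open import Function using (_∘_; id)
open import Relation.Nullary using (Dec; _because_; does; yes; no; ¬_; contradiction)
open import Relation.Unary using (Pred; Decidable)
open import Relation.Binary.PropositionalEquality

𝟙 : ∀ {p} {P : Set p} → Dec P → ℕ
𝟙 d = if does d then 1 else 0

𝟙≤1 : ∀ {p} {P : Set p} (d : Dec P) → 𝟙 d ≤ 1
𝟙≤1 (true  because _) = ≤-refl
𝟙≤1 (false because _) = z≤n

𝟙-≟-sym : ∀ {n} (i j : Fin n) → 𝟙 (i ≟ j) ≡ 𝟙 (j ≟ i)
𝟙-≟-sym i j with i ≟ j | j ≟ i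
... | yes _   | yes _   = refl
... | no  _   | no  _   = refl
... | yes i≡j | no  j≢i = contradiction (sym i≡j) j≢i
... | no  i≢j | yes j≡i = contradiction (sym j≡i) i≢j

∑-const : ∀ n (a : ℕ) → ∑[ i < n ] a ≡ n * a
∑-const zero    a = refl
∑-const (suc n) a = cong (a +_) (∑-const n a)

∑-mono-≤ : ∀ {n} {f g : Fin n → ℕ} → (∀ i → f i ≤ g i) → sum f ≤ sum g
∑-mono-≤ {zero}  f≤g = z≤n
∑-mono-≤ {suc n} f≤g = +-mono-≤ (f≤g zero) (∑-mono-≤ (f≤g ∘ suc))

∑-mono-< : ∀ {n} {f g : Fin n → ℕ} → (∀ i → f i ≤ g i) → ∀ j → f j < g j → sum f < sum g
∑-mono-< f≤g zero    fj<gj = +-mono-<-≤ fj<gj (∑-mono-≤ (f≤g ∘ suc))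
∑-mono-< f≤g (suc j) fj<gj = +-mono-≤-< (f≤g zero) (∑-mono-< (f≤g ∘ suc) j fj<gj)

∑-𝟙≤ : ∀ {n p} {P : Pred (Fin n) p} (P? : Decidable P) → ∑[ i < n ] 𝟙 (P? i) ≤ n
∑-𝟙≤ {zero}  P? = z≤n
∑-𝟙≤ {suc n} P? = +-mono-≤ (𝟙≤1 (P? zero)) (∑-𝟙≤ (P? ∘ suc))

∑-δ : ∀ {n} (j : Fin n) (f : Fin n → ℕ) → ∑[ i < n ] (𝟙 (i ≟ j) * f i) ≡ f j
∑-δ {suc n} zero f = trans (cong₂ _+_ (+-identityʳ (f zero)) (sum-replicate-zero n)) (+-identityʳ (f zero))
∑-δ (suc j) f = ∑-δ j (f ∘ suc)

∑-𝟙-≟ : ∀ {n} (i : Fin n) → ∑[ j < n ] 𝟙 (i ≟ j) ≡ 1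
∑-𝟙-≟ {suc n} zero = cong suc (sum-replicate-zero n)
∑-𝟙-≟ (suc i) = ∑-𝟙-≟ i

∑-*-𝟙-≟ : ∀ {n} (a : ℕ) (i : Fin n) → ∑[ j < n ] (a * 𝟙 (i ≟ j)) ≡ a
∑-*-𝟙-≟ a i = trans (sym (*-distribˡ-sum a (λ j → 𝟙 (i ≟ j)))) (trans (cong (a *_) (∑-𝟙-≟ i)) (*-identityʳ a))

∑∑-distrib-+ : ∀ {m n} (f g : Fin m → Fin n → ℕ) →
  ∑[ i < m ] ∑[ j < n ] (f i j + g i j) ≡ ∑[ i < m ] ∑[ j < n ] f i j + ∑[ i < m ] ∑[ j < n ] g i j
∑∑-distrib-+ {m} {n} f g =
  trans (sum-cong-≗ (λ i → ∑-distrib-+ (f i) (g i))) (∑-distrib-+ (λ i → ∑[ j < n ] f i j) (λ i → ∑[ j < n ] g i j))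

∑∑-+-cong : ∀ {m n} {f g f′ g′ : Fin m → Fin n → ℕ} → (∀ i j → f i j + g i j ≡ f′ i j + g′ i j) →
  ∑[ i < m ] ∑[ j < n ] f i j + ∑[ i < m ] ∑[ j < n ] g i j ≡ ∑[ i < m ] ∑[ j < n ] f′ i j + ∑[ i < m ] ∑[ j < n ] g′ i j
∑∑-+-cong {f = f} {g} {f′} {g′} eq =
  trans (sym (∑∑-distrib-+ f g)) (trans (sum-cong-≗ (sum-cong-≗ ∘ eq)) (∑∑-distrib-+ f′ g′))

argmin : ∀ {n} (f : Fin (suc n) → ℕ) → ∃ λ i → ∀ j → f i ≤ f j
argmin {zero}  f = zero , λ { zero → ≤-refl }
argmin {suc n} f with argmin (f ∘ suc)
... | i , min with f zero ≤? f (suc i)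
... | yes f0≤ = zero  , λ { zero → ≤-refl ; (suc j) → ≤-trans f0≤ (min j) }
... | no  f0≰ = suc i , λ { zero → <⇒≤ (≰⇒> f0≰) ; (suc j) → min j }

∃-≤-mean : ∀ {n} (f : Fin (suc n) → ℕ) → ∃ λ i → suc n * f i ≤ sum f
∃-≤-mean {n} f with argmin f
... | i , min = i , subst (_≤ sum f) (∑-const (suc n) (f i)) (∑-mono-≤ min)

length-filter-tabulate : ∀ {n a p} {A : Set a} {P : Pred A p} (P? : Decidable P) (f : Fin n → A) →
  length (filter P? (tabulate f)) ≡ ∑[ i < n ] 𝟙 (P? (f i))
length-filter-tabulate {zero}  P? f = refl
length-filter-tabulate {suc n} P? f with does (P? (f zero))
... | true  = cong suc (length-filter-tabulate P? (f ∘ suc))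
... | false = length-filter-tabulate P? (f ∘ suc)

length-filter-filter-tabulate : ∀ {n a p q} {A : Set a} {P : Pred A p} {Q : Pred A q}
  (P? : Decidable P) (Q? : Decidable Q) (f : Fin n → A) →
  length (filter Q? (filter P? (tabulate f))) ≡ ∑[ i < n ] (𝟙 (P? (f i)) * 𝟙 (Q? (f i)))
length-filter-filter-tabulate {zero}  P? Q? f = refl
length-filter-filter-tabulate {suc n} P? Q? f with does (P? (f zero))
... | false = length-filter-filter-tabulate P? Q? (f ∘ suc)
... | true with does (Q? (f zero))
...   | true  = cong suc (length-filter-filter-tabulate P? Q? (f ∘ suc))
...   | false = length-filter-filter-tabulate P? Q? (f ∘ suc)

m<n*[1+m/n] : ∀ m n .{{_ : NonZero n}} → m < n * suc (m / n)
m<n*[1+m/n] m n = begin-strict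
  m                   ≡⟨ m≡m%n+[m/n]*n m n ⟩
  m % n + m / n * n   <⟨ +-monoˡ-< (m / n * n) (m%n<n m n) ⟩
  n + m / n * n       ≡⟨ cong (n +_) (*-comm (m / n) n) ⟩
  n + n * (m / n)     ≡⟨ *-suc n (m / n) ⟨
  n * suc (m / n)     ∎
  where open ≤-Reasoning

n*[1+m/n]≤n+m : ∀ m n .{{_ : NonZero n}} → n * suc (m / n) ≤ n + m
n*[1+m/n]≤n+m m n = begin
  n * suc (m / n)   ≡⟨ *-suc n (m / n) ⟩
  n + n * (m / n)   ≡⟨ cong (n +_) (*-comm n (m / n)) ⟩
  n + m / n * n     ≤⟨ +-monoʳ-≤ n (m/n*n≤m m n) ⟩
  n + m             ∎
  where open ≤-Reasoning

module WeightedDigraph {N : ℕ} (A : Fin N → Fin N → ℕ) where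

  deg : Fin N → ℕ
  deg v = ∑[ w < N ] A v w

  inflow : (Fin N → ℕ) → Fin N → ℕ
  inflow x v = ∑[ u < N ] (x u * A u v)

  Balanced : (Fin N → ℕ) → Set
  Balanced x = ∀ v → inflow x v ≤ suc (deg v) * x v

  ∑-inflow : ∀ x → ∑[ v < N ] inflow x v ≡ ∑[ u < N ] (x u * deg u)
  ∑-inflow x = trans (sym (∑-comm (λ u v → x u * A u v)))
                     (sum-cong-≗ (λ u → sym (*-distribˡ-sum (x u) (A u))))

  inflow-mono : ∀ {x y} → (∀ u → x u ≤ y u) → ∀ v → inflow x v ≤ inflow y v
  inflow-mono x≤y v = ∑-mono-≤ (λ u → *-monoˡ-≤ (A u v) (x≤y u))

  module Balancing (Δ : ℕ) (deg≤Δ : ∀ v → deg v ≤ Δ) where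

    raise : (Fin N → ℕ) → Fin N → ℕ
    raise x v = suc (inflow x v / suc (deg v))

    raise-mono : ∀ {x y} → (∀ u → x u ≤ y u) → ∀ v → raise x v ≤ raise y v
    raise-mono x≤y v = s≤s (/-monoˡ-≤ (suc (deg v)) (inflow-mono x≤y v))

    potential : (Fin N → ℕ) → ℕ
    potential x = ∑[ v < N ] (suc (deg v) * x v)

    bound : ℕ
    bound = suc Δ * potential (λ _ → 1)

    potential-raise : ∀ x → potential (raise x) ≤ potential (λ _ → 1) + ∑[ u < N ] (x u * deg u)
    potential-raise x = begin
      potential (raise x)                             ≤⟨ ∑-mono-≤ (λ v → n*[1+m/n]≤n+m (inflow x v) (suc (deg v))) ⟩
      ∑[ v < N ] (suc (deg v) + inflow x v)           ≡⟨ ∑-distrib-+ (λ v → suc (deg v)) (inflow x) ⟩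
      ∑[ v < N ] suc (deg v) + ∑[ v < N ] inflow x v  ≡⟨ cong₂ _+_ (sum-cong-≗ (λ v → sym (*-identityʳ (suc (deg v)))))
                                                                    (∑-inflow x) ⟩
      potential (λ _ → 1) + ∑[ u < N ] (x u * deg u)  ∎
      where open ≤-Reasoning

    -- potential (raise x) ≤ P₁ + Δ/(Δ+1) · potential x, and bound = (Δ+1) P₁ is the fixed point of this map.
    potential-raise-≤-bound : ∀ x → potential x ≤ bound → potential (raise x) ≤ bound
    potential-raise-≤-bound x px≤bound = *-cancelˡ-≤ (suc Δ) (begin
      suc Δ * potential (raise x)                  ≤⟨ *-monoʳ-≤ (suc Δ) (potential-raise x) ⟩
      suc Δ * (P₁ + S)                             ≡⟨ *-distribˡ-+ (suc Δ) P₁ S ⟩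
      suc Δ * P₁ + suc Δ * S                       ≤⟨ +-monoʳ-≤ (suc Δ * P₁) [1+Δ]S≤Δpx ⟩
      suc Δ * P₁ + Δ * potential x                 ≤⟨ +-monoʳ-≤ (suc Δ * P₁) (*-monoʳ-≤ Δ px≤bound) ⟩
      suc Δ * P₁ + Δ * bound                       ≡⟨⟩
      suc Δ * bound                                ∎)
      where
      open ≤-Reasoning
      P₁ = potential (λ _ → 1)
      S = ∑[ u < N ] (x u * deg u)
      pointwise : ∀ u → suc Δ * (x u * deg u) ≤ Δ * (suc (deg u) * x u)
      pointwise u = begin
        suc Δ * (x u * deg u)           ≡⟨ expandˡ Δ (x u) (deg u) ⟩
        x u * deg u + Δ * (x u * deg u)  ≤⟨ +-monoˡ-≤ _ (subst (x u * deg u ≤_) (*-comm (x u) Δ) (*-monoʳ-≤ (x u) (deg≤Δ u))) ⟩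
        Δ * x u + Δ * (x u * deg u)      ≡⟨ expandʳ Δ (x u) (deg u) ⟨
        Δ * (suc (deg u) * x u)         ∎
        where
        expandˡ : ∀ c a b → suc c * (a * b) ≡ a * b + c * (a * b)
        expandˡ = solve-∀
        expandʳ : ∀ c a b → c * (suc b * a) ≡ c * a + c * (a * b)
        expandʳ = solve-∀
      [1+Δ]S≤Δpx : suc Δ * S ≤ Δ * potential x
      [1+Δ]S≤Δpx = subst₂ _≤_ (sym (*-distribˡ-sum (suc Δ) (λ u → x u * deg u)))
                              (sym (*-distribˡ-sum Δ (λ v → suc (deg v) * x v)))
                              (∑-mono-≤ pointwise)

    raise-increases : ∀ x v → ¬ inflow x v ≤ suc (deg v) * x v → x v < raise x v
    raise-increases x v unbalanced = *-cancelˡ-< (suc (deg v)) (x v) (raise x v)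
      (<-trans (≰⇒> unbalanced) (m<n*[1+m/n] (inflow x v) (suc (deg v))))

    -- The potential strictly increases along the iteration but stays below bound, so bound + 1 steps suffice.
    raise-until-balanced : ∀ fuel x → (∀ v → 1 ≤ x v) → (∀ v → x v ≤ raise x v) →
                           potential x ≤ bound → bound < fuel + potential x →
                           Σ (Fin N → ℕ) λ y → (∀ v → 1 ≤ y v) × Balanced y
    raise-until-balanced zero x _ _ px≤bound bound<px = contradiction px≤bound (<⇒≱ bound<px)
    raise-until-balanced (suc fuel) x x-pos x≤raise px≤bound bound<fuel+px
      with all? (λ v → inflow x v ≤? suc (deg v) * x v)
    ... | yes balanced = x , x-pos , balanced
    ... | no unbalanced with ¬∀⟶∃¬ N _ (λ v → inflow x v ≤? suc (deg v) * x v) unbalanced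
    ... | v , unbalanced-at-v =
      raise-until-balanced fuel (raise x) (λ _ → s≤s z≤n) (raise-mono x≤raise)
        (potential-raise-≤-bound x px≤bound)
        (<-≤-trans bound<fuel+px (≤-trans (≤-reflexive (sym (+-suc fuel _))) (+-monoʳ-≤ fuel px<praise)))
      where
      px<praise : potential x < potential (raise x)
      px<praise = ∑-mono-< (λ u → *-monoʳ-≤ (suc (deg u)) (x≤raise u)) v
                           (*-monoʳ-< (suc (deg v)) (raise-increases x v unbalanced-at-v))

    balanced-weighting : Σ (Fin N → ℕ) λ x → (∀ v → 1 ≤ x v) × Balanced x
    balanced-weighting = raise-until-balanced (suc bound) (λ _ → 1) (λ _ → ≤-refl) (λ _ → s≤s z≤n)
                                              (m≤n*m (potential (λ _ → 1)) (suc Δ)) (m≤m+n (suc bound) _)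

  outColour : ∀ {m} → (Fin N → Fin m) → Fin N → Fin m → ℕ
  outColour c v j = ∑[ w < N ] (A v w * 𝟙 (c w ≟ j))

  IsMajority : ℕ → ∀ {m} → (Fin N → Fin m) → Set
  IsMajority k c = ∀ v → k * outColour c v (c v) ≤ deg v

  module LocalSearch (loopless : ∀ v → A v v ≡ 0) (x : Fin N → ℕ) (x-pos : ∀ v → 1 ≤ x v)
                     (x-balanced : Balanced x) (k : ℕ) where

    Colour : Set
    Colour = Fin (2 * suc k)

    monochromatic : (Fin N → Colour) → Fin N → Fin N → ℕ
    monochromatic c u w = x u * (A u w * 𝟙 (c w ≟ c u))

    conflicts : (Fin N → Colour) → ℕ
    conflicts c = ∑[ u < N ] ∑[ w < N ] monochromatic c u w

    inColour : (Fin N → Colour) → Fin N → Colour → ℕ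
    inColour c v j = ∑[ u < N ] (x u * (A u v * 𝟙 (c u ≟ j)))

    cost : (Fin N → Colour) → Fin N → Colour → ℕ
    cost c v j = x v * outColour c v j + inColour c v j

    costTerm : (Fin N → Colour) → Fin N → Colour → Fin N → Fin N → ℕ
    costTerm c v j u w = 𝟙 (u ≟ v) * (x v * (A v w * 𝟙 (c w ≟ j)))
                       + 𝟙 (w ≟ v) * (x u * (A u v * 𝟙 (c u ≟ j)))

    ∑∑-costTerm : ∀ c v j → ∑[ u < N ] ∑[ w < N ] costTerm c v j u w ≡ cost c v j
    ∑∑-costTerm c v j = begin
      ∑[ u < N ] ∑[ w < N ] costTerm c v j u w
        ≡⟨ ∑∑-distrib-+ (λ u w → 𝟙 (u ≟ v) * out w) (λ u w → 𝟙 (w ≟ v) * in′ u) ⟩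
      ∑[ u < N ] ∑[ w < N ] (𝟙 (u ≟ v) * out w) + ∑[ u < N ] ∑[ w < N ] (𝟙 (w ≟ v) * in′ u)
        ≡⟨ cong₂ _+_ (sum-cong-≗ (λ u → sym (*-distribˡ-sum (𝟙 (u ≟ v)) out)))
                     (sum-cong-≗ (λ u → ∑-δ v (λ _ → in′ u))) ⟩
      ∑[ u < N ] (𝟙 (u ≟ v) * sum out) + inColour c v j
        ≡⟨ cong (_+ inColour c v j) (trans (∑-δ v (λ _ → sum out))
                                           (sym (*-distribˡ-sum (x v) (λ w → A v w * 𝟙 (c w ≟ j))))) ⟩
      cost c v j ∎
      where
      open ≡-Reasoning
      out : Fin N → ℕ
      out w = x v * (A v w * 𝟙 (c w ≟ j))
      in′ : Fin N → ℕ
      in′ u = x u * (A u v * 𝟙 (c u ≟ j))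

    recolour : (Fin N → Colour) → Fin N → Colour → Fin N → Colour
    recolour c v j w = if does (w ≟ v) then j else c w

    monochromatic-recolour : ∀ c v j u w →
      monochromatic c u w + costTerm c v j u w ≡ monochromatic (recolour c v j) u w + costTerm c v (c v) u w
    monochromatic-recolour c v j u w with u ≟ v | w ≟ v
    ... | yes refl | yes refl rewrite loopless u = refl
    ... | yes refl | no _  = swap (x u * (A u w * 𝟙 (c w ≟ c u))) (x u * (A u w * 𝟙 (c w ≟ j)))
      where
      swap : ∀ a b → a + (1 * b + 0) ≡ b + (1 * a + 0)
      swap = solve-∀
    ... | no _  | yes refl rewrite 𝟙-≟-sym (c w) (c u) | 𝟙-≟-sym j (c u) =
      swap (x u * (A u w * 𝟙 (c u ≟ c w))) (x u * (A u w * 𝟙 (c u ≟ j)))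
      where
      swap : ∀ a b → a + (0 + 1 * b) ≡ b + (0 + 1 * a)
      swap = solve-∀
    ... | no _  | no _     = refl

    conflicts-recolour : ∀ c v j → conflicts c + cost c v j ≡ conflicts (recolour c v j) + cost c v (c v)
    conflicts-recolour c v j = begin
      conflicts c + cost c v j
        ≡⟨ cong (conflicts c +_) (∑∑-costTerm c v j) ⟨
      conflicts c + ∑[ u < N ] ∑[ w < N ] costTerm c v j u w
        ≡⟨ ∑∑-+-cong (monochromatic-recolour c v j) ⟩
      conflicts (recolour c v j) + ∑[ u < N ] ∑[ w < N ] costTerm c v (c v) u w
        ≡⟨ cong (conflicts (recolour c v j) +_) (∑∑-costTerm c v (c v)) ⟩
      conflicts (recolour c v j) + cost c v (c v) ∎
      where open ≡-Reasoning

    ∑-cost : ∀ c v → ∑[ j < 2 * suc k ] cost c v j ≡ x v * deg v + inflow x v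
    ∑-cost c v = begin
      ∑[ j < 2 * suc k ] cost c v j
        ≡⟨ ∑-distrib-+ (λ j → x v * outColour c v j) (inColour c v) ⟩
      ∑[ j < 2 * suc k ] (x v * outColour c v j) + ∑[ j < 2 * suc k ] inColour c v j
        ≡⟨ cong₂ _+_ (trans (sym (*-distribˡ-sum (x v) (outColour c v))) (cong (x v *_) ∑-outColour))
                     ∑-inColour ⟩
      x v * deg v + inflow x v ∎
      where
      open ≡-Reasoning
      ∑-outColour : ∑[ j < 2 * suc k ] outColour c v j ≡ deg v
      ∑-outColour = trans (sym (∑-comm (λ w j → A v w * 𝟙 (c w ≟ j))))
                          (sum-cong-≗ (λ w → ∑-*-𝟙-≟ (A v w) (c w)))
      ∑-inColour : ∑[ j < 2 * suc k ] inColour c v j ≡ inflow x v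
      ∑-inColour = trans (sym (∑-comm (λ u j → x u * (A u v * 𝟙 (c u ≟ j)))))
        (sum-cong-≗ (λ u → trans (sym (*-distribˡ-sum (x u) (λ j → A u v * 𝟙 (c u ≟ j))))
                                 (cong (x u *_) (∑-*-𝟙-≟ (A u v) (c u)))))

    cost-below-current : ∀ c v j → ¬ suc k * outColour c v (c v) ≤ deg v →
                         2 * suc k * cost c v j ≤ ∑[ i < 2 * suc k ] cost c v i → cost c v j < cost c v (c v)
    cost-below-current c v j violated j≤mean = *-cancelˡ-< (2 * suc k) (cost c v j) (cost c v (c v)) (begin-strict
      2 * suc k * cost c v j           ≤⟨ j≤mean ⟩
      ∑[ i < 2 * suc k ] cost c v i    ≡⟨ ∑-cost c v ⟩
      X * d + inflow x v               ≤⟨ +-monoʳ-≤ (X * d) (x-balanced v) ⟩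
      X * d + suc d * X                <⟨ m<m+n (X * d + suc d * X) (x-pos v) ⟩
      X * d + suc d * X + X            ≡⟨ double X d ⟩
      2 * (X * suc d)                  ≤⟨ *-monoʳ-≤ 2 (*-monoʳ-≤ X (≰⇒> violated)) ⟩
      2 * (X * (suc k * o))            ≡⟨ reassoc X (suc k) o ⟩
      2 * suc k * (X * o)              ≤⟨ *-monoʳ-≤ (2 * suc k) (m≤m+n (X * o) (inColour c v (c v))) ⟩
      2 * suc k * cost c v (c v)       ∎)
      where
      open ≤-Reasoning
      X = x v
      d = deg v
      o = outColour c v (c v)
      double : ∀ X d → X * d + suc d * X + X ≡ 2 * (X * suc d)
      double = solve-∀
      reassoc : ∀ X K o → 2 * (X * (K * o)) ≡ 2 * K * (X * o)
      reassoc = solve-∀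

    descend : ∀ fuel c → conflicts c < fuel → Σ (Fin N → Colour) (IsMajority (suc k))
    descend zero       c ()
    descend (suc fuel) c conflicts<fuel with all? (λ v → suc k * outColour c v (c v) ≤? deg v)
    ... | yes majority = c , majority
    ... | no ¬majority with ¬∀⟶∃¬ N _ (λ v → suc k * outColour c v (c v) ≤? deg v) ¬majority
    ... | v , violated with ∃-≤-mean (cost c v)
    ... | j , j≤mean = descend fuel (recolour c v j) (<-≤-trans fewer-conflicts (≤-pred conflicts<fuel))
      where
      fewer-conflicts : conflicts (recolour c v j) < conflicts c
      fewer-conflicts = +-cancelʳ-< (cost c v (c v)) (conflicts (recolour c v j)) (conflicts c)
        (subst (_< conflicts c + cost c v (c v)) (conflicts-recolour c v j)
               (+-monoʳ-< (conflicts c) (cost-below-current c v j violated j≤mean)))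

    majority-colouring : Σ (Fin N → Colour) (IsMajority (suc k))
    majority-colouring = descend (suc (conflicts (λ _ → zero))) (λ _ → zero) ≤-refl

arcs : (D : Digraph) → Fin (n D) → Fin (n D) → ℕ
arcs D u w = 𝟙 (arc D u w ≟ᵇ true)

module _ (D : Digraph) where
  open WeightedDigraph (arcs D)

  arcs-loopless : ∀ v → arcs D v v ≡ 0
  arcs-loopless v rewrite loopless D v = refl

  deg≤n : ∀ v → deg v ≤ n D
  deg≤n v = ∑-𝟙≤ (λ w → arc D v w ≟ᵇ true)

  outdeg≡deg : ∀ v → outdeg D v ≡ deg v
  outdeg≡deg v = length-filter-tabulate (λ w → arc D v w ≟ᵇ true) id

  sameOut≡outColour : ∀ {m} (c : Fin (n D) → Fin m) v → sameOut D c v ≡ outColour c v (c v)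
  sameOut≡outColour c v = length-filter-filter-tabulate (λ w → arc D v w ≟ᵇ true) (λ w → c w ≟ c v) id

  majority-colouring : ∀ k → Σ (Fin (n D) → Fin (2 * suc k)) (IsMajorityColouring (suc k) D)
  majority-colouring k with Balancing.balanced-weighting (n D) deg≤n
  ... | x , x-pos , x-balanced with LocalSearch.majority-colouring arcs-loopless x x-pos x-balanced k
  ... | c , majority = c , λ v → subst₂ (λ s d → suc k * s ≤ d)
                                        (sym (sameOut≡outColour c v)) (sym (outdeg≡deg v)) (majority v)

theorem1 : (k : ℕ) → 2 ≤ k → (D : Digraph) →
    Σ (Fin (n D) → Fin (2 * k)) (λ c → IsMajorityColouring k D c)
theorem1 zero    ()  D
theorem1 (suc k) _   D = majority-colouring D k
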